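{- Let $n \geqslant 3$ and let $k$ be a positive integer with $k \geqslant n-3$. Let $f \colon V(C_n) \to \{0,1,2,\ldots\}$ be injective, and order the vertices as $x_0, x_1, \ldots, x_{n-1}$ so that $f(x_0) < f(x_1) < \cdots < f(x_{n-1})$. For $i \in \{0, \ldots, n-2\}$ let $f_i = f(x_{i+1}) - f(x_i)$ and $d_i = d(x_{i+1}, x_i)$. Then $f$ is a radio-$k$-labeling of $C_n$ if and only if $f_i \geqslant k - d_i + 1$ for all $i \in \{0, 1, \ldots, n-2\}$.
   Context: $C_n$ is the cycle on vertex set $\mathbb{Z}_n = \{0,1,\ldots,n-1\}$, with $u,v$ adjacent iff $u \equiv v \pm 1 \pmod n$; $d(u,v)$ is the graph distance in $C_n$. For a positive integer $k$, a radio-$k$-labeling of a graph $G$ is a function $f \colon V(G) \to \{0,1,2,\ldots\}$ such that $|f(u) - f(v)| \geqslant k - d(u,v) + 1$ for all distinct $u, v \in V(G)$. -}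

module Defs where

open import Data.Nat using (ℕ; _+_; _∸_; _⊓_; _≤_; ∣_-_∣)
open import Data.Fin using (Fin; toℕ)
open import Relation.Binary.PropositionalEquality using (_≢_)

-- Graph distance in the cycle C_n on vertex set Z_n = Fin n
-- (u ~ v iff u ≡ v ± 1 mod n): the shorter way around the cycle.
cycDist : (n : ℕ) → Fin n → Fin n → ℕ
cycDist n u v = ∣ toℕ u - toℕ v ∣ ⊓ (n ∸ ∣ toℕ u - toℕ v ∣)

-- f is a radio-k-labeling of C_n:
-- |f(u) - f(v)| ≥ k - d(u,v) + 1 for all distinct u, v.
-- (The right-hand side is written with truncated subtraction; since the
--  left-hand side is ≥ 0 this is equivalent to the integer inequality.)
IsRadioLabeling : (n k : ℕ) → (Fin n → ℕ) → Set
IsRadioLabeling n k f =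
  ∀ (u v : Fin n) → u ≢ v → (k + 1) ∸ cycDist n u v ≤ ∣ f u - f v ∣

-- For x_i, x_{i+1}, x_{i+2} the gaps give f(x_{i+2}) − f(x_i) ≥ 2k + 2 − (d_i + d_{i+1}),
-- and since the three arcs between three distinct vertices of C_n partition the cycle,
-- d_i + d_{i+1} + d(x_i, x_{i+2}) ≤ n, so d_i + d_{i+1} ≤ n − 1 ≤ k + 2 and the labels
-- differ by at least k. As labels increase along the order, any two vertices at least two
-- steps apart have labels at least k ≥ k + 1 − d apart, because their distance d is ≥ 1.
module Submission where

open import Defs
open import Data.Fin using (Fin; toℕ; fromℕ<)
open import Data.Fin.Properties using (toℕ-injective; toℕ<n; toℕ-fromℕ<)
open import Data.List using (_∷_; [])
open import Data.Nat using (ℕ; suc; _+_; _∸_; _≤_; _<_; _≥_; ∣_-_∣; s≤s)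
open import Data.Nat.Properties
open import Data.Nat.Tactic.RingSolver using (solve)
open import Data.Product using (_,_)
open import Data.Sum using (inj₁; inj₂)
open import Function.Base using (_∘_)
open import Function.Bundles using (_⇔_; mk⇔; Equivalence)
open import Function.Definitions using (Injective; Surjective; Bijective)
open import Relation.Binary.Definitions using (tri<; tri≈; tri>)
open import Relation.Binary.PropositionalEquality
open import Relation.Nullary using (contradiction)

private variable
  n : ℕ
  u v w : Fin n

m≤n≤o⇒∣m-n∣+∣n-o∣≡∣o-m∣ : ∀ {m n o} → m ≤ n → n ≤ o → ∣ m - n ∣ + ∣ n - o ∣ ≡ ∣ o - m ∣
m≤n≤o⇒∣m-n∣+∣n-o∣≡∣o-m∣ {m} {n} {o} m≤n n≤o = begin
  ∣ m - n ∣ + ∣ n - o ∣ ≡⟨ cong₂ _+_ (m≤n⇒∣m-n∣≡n∸m m≤n) (m≤n⇒∣m-n∣≡n∸m n≤o) ⟩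
  (n ∸ m) + (o ∸ n)     ≡⟨ +-comm (n ∸ m) (o ∸ n) ⟩
  (o ∸ n) + (n ∸ m)     ≡⟨ sym (+-∸-assoc (o ∸ n) m≤n) ⟩
  (o ∸ n) + n ∸ m       ≡⟨ cong (_∸ m) (m∸n+n≡m n≤o) ⟩
  o ∸ m                 ≡⟨ sym (m≤n⇒∣n-m∣≡n∸m (≤-trans m≤n n≤o)) ⟩
  ∣ o - m ∣             ∎
  where open ≡-Reasoning

m∸d≤b∸a⇔m+a≤b+d : ∀ {m d a b} → a ≤ b → m ∸ d ≤ b ∸ a ⇔ m + a ≤ b + d
m∸d≤b∸a⇔m+a≤b+d {m} {d} {a} {b} a≤b = mk⇔ to from
  where
  open ≤-Reasoning
  to : m ∸ d ≤ b ∸ a → m + a ≤ b + d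
  to m∸d≤b∸a = begin
    m + a             ≤⟨ +-monoˡ-≤ a (m≤n+m∸n m d) ⟩
    d + (m ∸ d) + a   ≤⟨ +-monoˡ-≤ a (+-monoʳ-≤ d m∸d≤b∸a) ⟩
    d + (b ∸ a) + a   ≡⟨ +-assoc d (b ∸ a) a ⟩
    d + (b ∸ a + a)   ≡⟨ cong (d +_) (m∸n+n≡m a≤b) ⟩
    d + b             ≡⟨ +-comm d b ⟩
    b + d             ∎
  from : m + a ≤ b + d → m ∸ d ≤ b ∸ a
  from m+a≤b+d = m≤n+o⇒m∸n≤o m d (begin
    m                 ≤⟨ m+n≤o⇒m≤o∸n m m+a≤b+d ⟩
    b + d ∸ a         ≡⟨ +-∸-comm d a≤b ⟩
    b ∸ a + d         ≡⟨ +-comm (b ∸ a) d ⟩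
    d + (b ∸ a)       ∎)

cycDist-sym : (u v : Fin n) → cycDist n u v ≡ cycDist n v u
cycDist-sym u v rewrite ∣-∣-comm (toℕ u) (toℕ v) = refl

∣toℕ-toℕ∣<n : (u v : Fin n) → ∣ toℕ u - toℕ v ∣ < n
∣toℕ-toℕ∣<n u v = ≤-<-trans (∣m-n∣≤m⊔n (toℕ u) (toℕ v)) (⊔-pres-<m (toℕ<n u) (toℕ<n v))

cycDist-pos : u ≢ v → 0 < cycDist n u v
cycDist-pos {u = u} {v} u≢v = ⊓-glb
  (n≢0⇒n>0 (u≢v ∘ toℕ-injective ∘ ∣m-n∣≡0⇒m≡n))
  (m<n⇒0<n∸m (∣toℕ-toℕ∣<n u v))

cycDist≤∣-∣ : (u v : Fin n) → cycDist n u v ≤ ∣ toℕ u - toℕ v ∣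
cycDist≤∣-∣ u v = m⊓n≤m _ _

cycDist≤n∸∣-∣ : (u v : Fin n) → cycDist n u v ≤ n ∸ ∣ toℕ u - toℕ v ∣
cycDist≤n∸∣-∣ u v = m⊓n≤n _ _

perimeter : (n : ℕ) → Fin n → Fin n → Fin n → ℕ
perimeter n u v w = cycDist n u v + cycDist n v w + cycDist n w u

perimeter-rotate : (u v w : Fin n) → perimeter n u v w ≡ perimeter n v w u
perimeter-rotate {n} u v w =
  trans (+-assoc (cycDist n u v) _ _) (+-comm (cycDist n u v) _)

perimeter-reverse : (u v w : Fin n) → perimeter n u v w ≡ perimeter n w v u
perimeter-reverse {n} u v w = begin
  cycDist n u v + cycDist n v w + cycDist n w u
    ≡⟨ cong (_+ cycDist n w u) (+-comm (cycDist n u v) _) ⟩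
  cycDist n v w + cycDist n u v + cycDist n w u
    ≡⟨ cong₂ (λ a b → a + b + cycDist n w u) (cycDist-sym v w) (cycDist-sym u v) ⟩
  cycDist n w v + cycDist n v u + cycDist n w u
    ≡⟨ cong (cycDist n w v + cycDist n v u +_) (cycDist-sym w u) ⟩
  cycDist n w v + cycDist n v u + cycDist n u w ∎
  where open ≡-Reasoning

perimeter-sorted : toℕ u ≤ toℕ v → toℕ v ≤ toℕ w → perimeter n u v w ≤ n
perimeter-sorted {n} {u} {v} {w} u≤v v≤w = begin
  perimeter n u v w
    ≤⟨ +-mono-≤ (+-mono-≤ (cycDist≤∣-∣ u v) (cycDist≤∣-∣ v w)) (cycDist≤n∸∣-∣ w u) ⟩
  ∣ toℕ u - toℕ v ∣ + ∣ toℕ v - toℕ w ∣ + (n ∸ ∣ toℕ w - toℕ u ∣)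
    ≡⟨ cong (_+ (n ∸ ∣ toℕ w - toℕ u ∣)) (m≤n≤o⇒∣m-n∣+∣n-o∣≡∣o-m∣ u≤v v≤w) ⟩
  ∣ toℕ w - toℕ u ∣ + (n ∸ ∣ toℕ w - toℕ u ∣)
    ≡⟨ m+[n∸m]≡n (<⇒≤ (∣toℕ-toℕ∣<n w u)) ⟩
  n ∎
  where open ≤-Reasoning

perimeter-from-min : toℕ u ≤ toℕ v → toℕ u ≤ toℕ w → perimeter n u v w ≤ n
perimeter-from-min {u = u} {v} {w} u≤v u≤w with ≤-total (toℕ v) (toℕ w)
... | inj₁ v≤w = perimeter-sorted u≤v v≤w
... | inj₂ w≤v = begin
  perimeter _ u v w ≡⟨ perimeter-reverse u v w ⟩
  perimeter _ w v u ≡⟨ perimeter-rotate w v u ⟩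
  perimeter _ v u w ≡⟨ perimeter-rotate v u w ⟩
  perimeter _ u w v ≤⟨ perimeter-sorted u≤w w≤v ⟩
  _                 ∎
  where open ≤-Reasoning

perimeter≤n : (u v w : Fin n) → perimeter n u v w ≤ n
perimeter≤n {n} u v w with ≤-total (toℕ u) (toℕ v) | ≤-total (toℕ u) (toℕ w) | ≤-total (toℕ v) (toℕ w)
... | inj₁ u≤v | inj₁ u≤w | _        = perimeter-from-min u≤v u≤w
... | inj₁ u≤v | inj₂ w≤u | _        =
  subst (_≤ n) (perimeter-rotate w u v) (perimeter-from-min w≤u (≤-trans w≤u u≤v))
... | inj₂ v≤u | _        | inj₁ v≤w =
  subst (_≤ n) (sym (perimeter-rotate u v w)) (perimeter-from-min v≤w v≤u)
... | inj₂ v≤u | _        | inj₂ w≤v =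
  subst (_≤ n) (perimeter-rotate w u v) (perimeter-from-min (≤-trans w≤v v≤u) w≤v)

cycDist-path<n : u ≢ w → cycDist n u v + cycDist n v w < n
cycDist-path<n {n = n} {u} {w} {v} u≢w = begin-strict
  cycDist n u v + cycDist n v w     <⟨ m<m+n _ (cycDist-pos (u≢w ∘ sym)) ⟩
  perimeter n u v w                 ≤⟨ perimeter≤n u v w ⟩
  n                                 ∎
  where open ≤-Reasoning

two-gaps : ∀ {k a b c d₁ d₂} → k + 1 + a ≤ b + d₁ → k + 1 + b ≤ c + d₂ → d₂ + d₁ < k + 3 →
           k + a ≤ c
two-gaps {k} {a} {b} {c} {d₁} {d₂} gap₁ gap₂ short = +-cancelʳ-≤ (k + 3) (k + a) c (begin
  k + a + (k + 3)           ≡⟨ solve (k ∷ a ∷ []) ⟩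
  suc (k + 1 + a + (k + 1)) ≤⟨ s≤s (+-monoˡ-≤ (k + 1) gap₁) ⟩
  suc (b + d₁ + (k + 1))    ≡⟨ cong suc (solve (k ∷ b ∷ d₁ ∷ [])) ⟩
  suc (k + 1 + b + d₁)      ≤⟨ s≤s (+-monoˡ-≤ d₁ gap₂) ⟩
  suc (c + d₂ + d₁)         ≡⟨ solve (c ∷ d₂ ∷ d₁ ∷ []) ⟩
  c + suc (d₂ + d₁)         ≤⟨ +-monoʳ-≤ c short ⟩
  c + (k + 3)               ∎)
  where open ≤-Reasoning

radio-from-increasing-pairs : ∀ {n k} {f : Fin n → ℕ} → Injective _≡_ _≡_ f →
  (∀ u v → f u < f v → (k + 1) ∸ cycDist n v u ≤ f v ∸ f u) → IsRadioLabeling n k f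
radio-from-increasing-pairs {n} {k} {f} f-inj gap u v u≢v with <-cmp (f u) (f v)
... | tri< fu<fv _ _ = subst₂ (λ d g → (k + 1) ∸ d ≤ g)
  (cycDist-sym v u) (sym (m≤n⇒∣m-n∣≡n∸m (<⇒≤ fu<fv))) (gap u v fu<fv)
... | tri≈ _ fu≡fv _ = contradiction (f-inj fu≡fv) u≢v
... | tri> _ _ fv<fu = subst ((k + 1) ∸ cycDist n u v ≤_)
  (sym (m≤n⇒∣n-m∣≡n∸m (<⇒≤ fv<fu))) (gap v u fv<fu)

module SortedLabelling (k : ℕ) {n : ℕ} (f : Fin n → ℕ) (x : Fin n → Fin n)
  (x-inj : Injective _≡_ _≡_ x)
  (sorted : ∀ (i j : Fin n) → toℕ i < toℕ j → f (x i) < f (x j)) where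

  private variable
    i j : Fin n

  RadioGap : Fin n → Fin n → Set
  RadioGap i j = (k + 1) ∸ cycDist n (x j) (x i) ≤ f (x j) ∸ f (x i)

  ConsecutiveGaps : Set
  ConsecutiveGaps = ∀ (i j : Fin n) → toℕ j ≡ suc (toℕ i) → RadioGap i j

  x-distinct : toℕ i < toℕ j → x i ≢ x j
  x-distinct i<j xi≡xj = <⇒≢ i<j (cong toℕ (x-inj xi≡xj))

  sorted-≤ : toℕ i ≤ toℕ j → f (x i) ≤ f (x j)
  sorted-≤ {i} {j} i≤j with m≤n⇒m<n∨m≡n i≤j
  ... | inj₁ i<j = <⇒≤ (sorted i j i<j)
  ... | inj₂ i≡j = ≤-reflexive (cong (f ∘ x) (toℕ-injective i≡j))

  sorted-reflects-< : f (x i) < f (x j) → toℕ i < toℕ j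
  sorted-reflects-< fi<fj = ≰⇒> (<⇒≱ fi<fj ∘ sorted-≤)

  radioGap⇔spaced : toℕ i < toℕ j →
    RadioGap i j ⇔ k + 1 + f (x i) ≤ f (x j) + cycDist n (x j) (x i)
  radioGap⇔spaced {i} {j} i<j = m∸d≤b∸a⇔m+a≤b+d (<⇒≤ (sorted i j i<j))

  radio⇒gaps : IsRadioLabeling n k f → ConsecutiveGaps
  radio⇒gaps radio i j j≡1+i =
    subst ((k + 1) ∸ cycDist n (x j) (x i) ≤_) (m≤n⇒∣n-m∣≡n∸m (<⇒≤ (sorted i j i<j)))
      (radio (x j) (x i) (x-distinct i<j ∘ sym))
    where
    i<j : toℕ i < toℕ j
    i<j = ≤-reflexive (sym j≡1+i)

  next : (i j : Fin n) → toℕ i < toℕ j → Fin n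
  next i j i<j = fromℕ< (≤-<-trans i<j (toℕ<n j))

  toℕ-next : (i<j : toℕ i < toℕ j) → toℕ (next i j i<j) ≡ suc (toℕ i)
  toℕ-next _ = toℕ-fromℕ< _

  module _ (n≤k+3 : n ≤ k + 3) (gaps : ConsecutiveGaps) where

    consecutive-spaced : toℕ j ≡ suc (toℕ i) → k + 1 + f (x i) ≤ f (x j) + cycDist n (x j) (x i)
    consecutive-spaced {j} {i} j≡1+i =
      Equivalence.to (radioGap⇔spaced (≤-reflexive (sym j≡1+i))) (gaps i j j≡1+i)

    two-apart : 2 + toℕ i ≤ toℕ j → k + f (x i) ≤ f (x j)
    two-apart {i} {j} 2+i≤j = ≤-trans
      (two-gaps (consecutive-spaced (toℕ-next i<j)) (consecutive-spaced (toℕ-next i₁<j))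
        (<-≤-trans (cycDist-path<n (x-distinct i<i₂ ∘ sym)) n≤k+3))
      (sorted-≤ i₂≤j)
      where
      i<j : toℕ i < toℕ j
      i<j = <-trans (n<1+n _) 2+i≤j
      i₁ = next i j i<j
      i₁<j : toℕ i₁ < toℕ j
      i₁<j = subst (_< toℕ j) (sym (toℕ-next i<j)) 2+i≤j
      i₂ = next i₁ j i₁<j
      i₂≤j : toℕ i₂ ≤ toℕ j
      i₂≤j = subst (_≤ toℕ j) (sym (toℕ-next i₁<j)) i₁<j
      i<i₂ : toℕ i < toℕ i₂
      i<i₂ = subst (toℕ i <_) (sym (trans (toℕ-next i₁<j) (cong suc (toℕ-next i<j)))) (s≤s (n≤1+n _))

    gaps⇒ordered : toℕ i < toℕ j → RadioGap i j
    gaps⇒ordered {i} {j} i<j with m≤n⇒m<n∨m≡n i<j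
    ... | inj₂ 1+i≡j = gaps i j (sym 1+i≡j)
    ... | inj₁ 2+i≤j = Equivalence.from (radioGap⇔spaced i<j) (begin
      k + 1 + f (x i)                ≡⟨ trans (+-assoc k 1 _) (+-suc k _) ⟩
      suc (k + f (x i))              ≡⟨ +-comm 1 _ ⟩
      k + f (x i) + 1                ≤⟨ +-mono-≤ (two-apart 2+i≤j) (cycDist-pos (x-distinct i<j ∘ sym)) ⟩
      f (x j) + cycDist n (x j) (x i) ∎)
      where open ≤-Reasoning

    gaps⇒radio : Injective _≡_ _≡_ f → Surjective _≡_ _≡_ x → IsRadioLabeling n k f
    gaps⇒radio f-inj x-surj = radio-from-increasing-pairs f-inj gap
      where
      gap : ∀ u v → f u < f v → (k + 1) ∸ cycDist n v u ≤ f v ∸ f u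
      gap u v fu<fv with x-surj u | x-surj v
      ... | i , xi≡u | j , xj≡v with xi≡u refl | xj≡v refl
      ... | refl | refl = gaps⇒ordered (sorted-reflects-< fu<fv)

lemma3p1 : (n k : ℕ) → n ≥ 3 → 1 ≤ k → k + 3 ≥ n →
    (f : Fin n → ℕ) → Injective _≡_ _≡_ f →
    (x : Fin n → Fin n) → Bijective _≡_ _≡_ x →
    (∀ (i j : Fin n) → toℕ i < toℕ j → f (x i) < f (x j)) →
    IsRadioLabeling n k f ⇔
      (∀ (i j : Fin n) → toℕ j ≡ suc (toℕ i) →
        (k + 1) ∸ cycDist n (x j) (x i) ≤ f (x j) ∸ f (x i))
lemma3p1 n k _ _ n≤k+3 f f-inj x (x-inj , x-surj) sorted =
  mk⇔ radio⇒gaps (λ gaps → gaps⇒radio n≤k+3 gaps f-inj x-surj)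
  where open SortedLabelling k f x x-inj sorted
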